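{- Let $d\geq2$ be an integer. Then for every $n\in\mathbb{N}$, coefficientwise: (a) if $d$ is a composite number greater than $4$, then $H_d(n,x)\equiv x^n\pmod d$; (b) if $d=4$, then $H_4(n,x)\equiv x^n+2\lfloor n/4\rfloor x^{n-4}=x^{n-4\varepsilon_n}(x^4+2)^{\varepsilon_n}\pmod 4$, where $\varepsilon_n\in\{0,1\}$ is the remainder of $\lfloor n/4\rfloor$ modulo $2$; (c) if $d$ is a prime number, then $H_d(n,x)\equiv x^{n\bmod d}(x-1)^{d\lfloor n/d\rfloor}\pmod d$, where $n\bmod d\in\{0,\dots,d-1\}$ is the remainder of $n$ modulo $d$.
   Context: $\mathbb{N}$ denotes the non-negative integers. For an integer $d\ge2$ the polynomials $H_d(n,x)\in\mathbb{Z}[x]$ are defined by $H_d(n,x)=x^n$ for $n\in\{0,\dots,d-1\}$ and $H_d(n,x)=xH_d(n-1,x)+(n-1)(n-2)\cdots(n-d+1)H_d(n-d,x)$ for $n\ge d$; explicitly $H_d(n,x)=\sum_{j=0}^{\lfloor n/d\rfloor}\frac{n!}{(n-dj)!\,j!\,d^j}x^{n-dj}$. -}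

module Defs where

open import Data.Nat as ℕ using (ℕ; zero; suc; _∸_; _<?_)
open import Data.Integer as ℤ using (ℤ; +_; _-_)
open import Data.Integer.Divisibility using (_∣_)
open import Relation.Nullary using (yes; no)

-- A polynomial in ℤ[x] is represented by its coefficient function:
-- p k is the coefficient of x^k (finite support is not enforced; all
-- polynomials constructed below have finite support).
Poly : Set
Poly = ℕ → ℤ

0ₚ : Poly
0ₚ _ = + 0

X^ : ℕ → Poly
X^ n k with k ℕ.≟ n
... | yes _ = + 1
... | no _  = + 0

const : ℤ → Poly
const c zero    = c
const c (suc _) = + 0

infixl 6 _+ₚ_ _−ₚ_
infixl 7 _⊗_ _·_

_+ₚ_ : Poly → Poly → Poly
(p +ₚ q) k = p k ℤ.+ q k

_−ₚ_ : Poly → Poly → Poly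
(p −ₚ q) k = p k ℤ.- q k

_·_ : ℤ → Poly → Poly
(c · p) k = c ℤ.* p k

xmul : Poly → Poly
xmul p zero    = + 0
xmul p (suc k) = p k

-- Cauchy product: (p ⊗ q) k = Σ_{i=0}^{k} p i * q (k - i)
conv : Poly → Poly → ℕ → ℕ → ℤ
conv p q k zero    = p 0 ℤ.* q k
conv p q k (suc i) = conv p q k i ℤ.+ p (suc i) ℤ.* q (k ∸ suc i)

_⊗_ : Poly → Poly → Poly
(p ⊗ q) k = conv p q k k

_^ₚ_ : Poly → ℕ → Poly
p ^ₚ zero  = X^ 0
p ^ₚ suc m = p ⊗ (p ^ₚ m)

fall : ℕ → ℕ → ℕ
fall n zero    = 1
fall n (suc m) = n ℕ.* fall (n ∸ 1) m

-- H_d(n,x) by the defining recurrence: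
--   H_d(n,x) = x^n                                           for n < d
--   H_d(n,x) = x H_d(n-1,x) + (n-1)(n-2)...(n-d+1) H_d(n-d,x) for n ≥ d
-- The recursion is structural on a fuel argument; since d ≥ 1 each
-- recursive call lowers n by at least 1, so fuel = n is sufficient
-- (for n ≤ fuel the fuel never runs out before n < d is reached).
Hfuel : ℕ → ℕ → ℕ → Poly
Hfuel d zero n = X^ n
Hfuel d (suc f) n with n <? d
... | yes _ = X^ n
... | no _  = xmul (Hfuel d f (n ∸ 1)) +ₚ (+ fall (n ∸ 1) (d ∸ 1)) · Hfuel d f (n ∸ d)

H : ℕ → ℕ → Poly
H d n = Hfuel d n n

_≡ₚ_[mod_] : Poly → Poly → ℕ → Set
p ≡ₚ q [mod m ] = ∀ k → (+ m) ∣ (p k ℤ.- q k)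

module Submission where

-- Modulo d the coefficient (n-1)(n-2)⋯(n-d+1) of the recurrence vanishes unless d ∣ n, since
-- one of its factors n - r (r = n mod d) is then a multiple of d; for n = (q+1)d it is
-- congruent to (d-1)!. Thus H_d(n,x) ≡ x H_d(n-1,x) except at multiples of d, where the term
-- (d-1)! H_d(n-d,x) is added. A composite d > 4 divides (d-1)!, so H_d(n,x) ≡ x^n. For d = 4,
-- (d-1)! = 6 ≡ 2, and every fourth step adds 2 x^(n-4). For a prime d, Wilson's theorem
-- gives (d-1)! ≡ -1, and the Frobenius congruence (x-1)^d ≡ x^d - 1 turns the step at
-- n = (q+1)d into multiplication of (x-1)^(qd) by (x-1)^d.

open import Defs
open import Data.Nat as ℕ using (ℕ; zero; suc; _∸_; _≤_; _<_; z≤n; s≤s; _!; _<?_; NonZero)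
import Data.Nat.Properties as ℕₚ
open import Data.Nat.DivMod
  using (_%_; _/_; m≡m%n+[m/n]*n; m%n<n; %-distribˡ-*; [m+kn]%n≡m%n; m<n⇒m%n≡m; m<n⇒m/n≡0; m*n/n≡m;
         +-distrib-/-∣ʳ; m/n≢0⇒n≤m)
open import Data.Nat.Divisibility
  using (_∣_; divides; n∣m*n; m∣m*n; ∣n⇒∣m*n; ∣-trans; *-monoʳ-∣; m≤n⇒m!∣n!; ∣⇒≤; n∣m⇒m%n≡0)
open import Data.Nat.Primality using (Prime; Composite; composite; euclidsLemma; prime⇒irreducible)
open import Data.Nat.Coprimality using (prime⇒coprime; coprime-Bézout)
open import Data.Nat.GCD using (module Bézout)
import Data.Nat.Tactic.RingSolver as ℕ-Solver
open import Data.Integer as ℤ using (ℤ; +_; -_; ∣_∣)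
import Data.Integer.Properties as ℤₚ
import Data.Integer.DivMod as ℤ÷
import Data.Integer.Divisibility.Signed as ℤ∣
open import Data.Integer.Tactic.RingSolver using (solve-∀)
open import Data.Empty using (⊥-elim)
open import Data.Product using (Σ-syntax; _×_; _,_; proj₁; proj₂)
open import Data.Sum using (_⊎_; inj₁; inj₂)
open import Function using (_∘_)
open import Relation.Binary.Bundles using (Setoid)
open import Relation.Binary.Definitions using (tri<; tri≈; tri>)
open import Relation.Binary.PropositionalEquality
import Relation.Binary.Reasoning.Setoid
open import Relation.Nullary using (yes; no; ¬_)

module Congruence (m : ℕ) where

  open import Data.Integer using (_+_; _-_; _*_)

  infix 4 _≈_ _≈ₚ_

  record _≈_ (a b : ℤ) : Set where
    constructor mk≈
    field divides-difference : + m ℤ∣.∣ a - b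
  open _≈_ public

  ≈-byDifference : ∀ {a b} c → a - b ≡ c → + m ℤ∣.∣ c → a ≈ b
  ≈-byDifference c eq m∣c = mk≈ (subst (+ m ℤ∣.∣_) (sym eq) m∣c)

  ≈-byQuotient : ∀ {a b} q → a - b ≡ q * + m → a ≈ b
  ≈-byQuotient q eq = mk≈ (ℤ∣.divides q eq)

  ≡⇒≈ : ∀ {a b} → a ≡ b → a ≈ b
  ≡⇒≈ {a} refl = ≈-byQuotient (+ 0) (ℤₚ.+-inverseʳ a)

  ≈-sym : ∀ {a b} → a ≈ b → b ≈ a
  ≈-sym {a} {b} (mk≈ m∣a-b) = ≈-byDifference (- (a - b)) (difference a b) (ℤ∣.∣m⇒∣-m m∣a-b)
    where difference : ∀ a b → b - a ≡ - (a - b)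
          difference = solve-∀

  ≈-trans : ∀ {a b c} → a ≈ b → b ≈ c → a ≈ c
  ≈-trans {a} {b} {c} (mk≈ m∣a-b) (mk≈ m∣b-c) =
    ≈-byDifference ((a - b) + (b - c)) (difference a b c) (ℤ∣.∣m∣n⇒∣m+n m∣a-b m∣b-c)
    where difference : ∀ a b c → a - c ≡ (a - b) + (b - c)
          difference = solve-∀

  ≈-setoid : Setoid _ _
  ≈-setoid = record
    { _≈_ = _≈_
    ; isEquivalence = record { refl = ≡⇒≈ refl ; sym = ≈-sym ; trans = ≈-trans } }

  +-cong : ∀ {a b c d} → a ≈ b → c ≈ d → a + c ≈ b + d
  +-cong {a} {b} {c} {d} (mk≈ m∣a-b) (mk≈ m∣c-d) =
    ≈-byDifference ((a - b) + (c - d)) (difference a b c d) (ℤ∣.∣m∣n⇒∣m+n m∣a-b m∣c-d)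
    where difference : ∀ a b c d → (a + c) - (b + d) ≡ (a - b) + (c - d)
          difference = solve-∀

  *-cong : ∀ {a b c d} → a ≈ b → c ≈ d → a * c ≈ b * d
  *-cong {a} {b} {c} {d} (mk≈ m∣a-b) (mk≈ m∣c-d) =
    ≈-byDifference ((a - b) * c + b * (c - d)) (difference a b c d)
      (ℤ∣.∣m∣n⇒∣m+n (ℤ∣.∣m⇒∣m*n c m∣a-b) (ℤ∣.∣n⇒∣m*n b m∣c-d))
    where difference : ∀ a b c d → a * c - b * d ≡ (a - b) * c + b * (c - d)
          difference = solve-∀

  *-congˡ : ∀ a {b c} → b ≈ c → a * b ≈ a * c
  *-congˡ a = *-cong (≡⇒≈ {a} refl)

  *-congʳ : ∀ {a b} → a ≈ b → ∀ c → a * c ≈ b * c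
  *-congʳ a≈b c = *-cong a≈b (≡⇒≈ {c} refl)

  ℤ∣⇒≈0 : ∀ {a} → + m ℤ∣.∣ a → a ≈ + 0
  ℤ∣⇒≈0 {a} = ≈-byDifference a (ℤₚ.+-identityʳ a)

  record _≈ₚ_ (P Q : Poly) : Set where
    constructor mk≈ₚ
    field coefficient : ∀ k → P k ≈ Q k
  open _≈ₚ_ public

  ≗⇒≈ₚ : ∀ {P Q} → P ≗ Q → P ≈ₚ Q
  ≗⇒≈ₚ P≗Q = mk≈ₚ λ k → ≡⇒≈ (P≗Q k)

  ≈ₚ-setoid : Setoid _ _
  ≈ₚ-setoid = record
    { _≈_ = _≈ₚ_
    ; isEquivalence = record
      { refl = ≗⇒≈ₚ (λ _ → refl)
      ; sym = λ P≈Q → mk≈ₚ λ k → ≈-sym (coefficient P≈Q k)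
      ; trans = λ P≈Q Q≈R → mk≈ₚ λ k → ≈-trans (coefficient P≈Q k) (coefficient Q≈R k) } }

  +ₚ-cong : ∀ {P Q R S} → P ≈ₚ Q → R ≈ₚ S → P +ₚ R ≈ₚ Q +ₚ S
  +ₚ-cong P≈Q R≈S = mk≈ₚ λ k → +-cong (coefficient P≈Q k) (coefficient R≈S k)

  ·-cong : ∀ {a b P Q} → a ≈ b → P ≈ₚ Q → a · P ≈ₚ b · Q
  ·-cong a≈b P≈Q = mk≈ₚ λ k → *-cong a≈b (coefficient P≈Q k)

  +ₚ-congˡ : ∀ P {Q R} → Q ≈ₚ R → P +ₚ Q ≈ₚ P +ₚ R
  +ₚ-congˡ P = +ₚ-cong (≗⇒≈ₚ {P} λ _ → refl)

  ·-congˡ : ∀ a {P Q} → P ≈ₚ Q → a · P ≈ₚ a · Q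
  ·-congˡ a = ·-cong (≡⇒≈ {a} refl)

  ·-congʳ : ∀ {a b} → a ≈ b → ∀ P → a · P ≈ₚ b · P
  ·-congʳ a≈b P = ·-cong a≈b (≗⇒≈ₚ {P} λ _ → refl)

  xmul-cong : ∀ {P Q} → P ≈ₚ Q → xmul P ≈ₚ xmul Q
  xmul-cong P≈Q = mk≈ₚ λ { zero → ≡⇒≈ refl ; (suc k) → coefficient P≈Q k }

  ≈ₚ⇒≡ₚ : ∀ {P Q} → P ≈ₚ Q → P ≡ₚ Q [mod m ]
  ≈ₚ⇒≡ₚ P≈Q k = ℤ∣.∣⇒∣ᵤ (divides-difference (coefficient P≈Q k))

  module ≈-Reasoning = Relation.Binary.Reasoning.Setoid ≈-setoid
  module ≈ₚ-Reasoning = Relation.Binary.Reasoning.Setoid ≈ₚ-setoid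

  %≡⇒≈ : ∀ .{{_ : NonZero m}} a b → a % m ≡ b % m → + a ≈ + b
  %≡⇒≈ a b a%m≡b%m = ≈-byQuotient (+ (a / m) - + (b / m)) (begin
    + a - + b
      ≡⟨ cong₂ (λ x y → + x - + y) (m≡m%n+[m/n]*n a m) (m≡m%n+[m/n]*n b m) ⟩
    + (a % m ℕ.+ a / m ℕ.* m) - + (b % m ℕ.+ b / m ℕ.* m)
      ≡⟨ cong (λ r → + (a % m ℕ.+ a / m ℕ.* m) - + (r ℕ.+ b / m ℕ.* m)) (sym a%m≡b%m) ⟩
    + (a % m ℕ.+ a / m ℕ.* m) - + (a % m ℕ.+ b / m ℕ.* m)
      ≡⟨ cong₂ _-_ (ℤₚ.pos-+ (a % m) _) (ℤₚ.pos-+ (a % m) _) ⟩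
    (+ (a % m) + + (a / m ℕ.* m)) - (+ (a % m) + + (b / m ℕ.* m))
      ≡⟨ cong₂ (λ x y → (+ (a % m) + x) - (+ (a % m) + y)) (ℤₚ.pos-* (a / m) m) (ℤₚ.pos-* (b / m) m) ⟩
    (+ (a % m) + + (a / m) * + m) - (+ (a % m) + + (b / m) * + m)
      ≡⟨ difference (+ (a % m)) (+ (a / m)) (+ (b / m)) (+ m) ⟩
    (+ (a / m) - + (b / m)) * + m ∎)
    where
    open ≡-Reasoning
    difference : ∀ r x y m → (r + x * m) - (r + y * m) ≡ (x - y) * m
    difference = solve-∀

  ∣⇒≈0 : ∀ {a} → m ∣ a → + a ≈ + 0
  ∣⇒≈0 m∣a = ℤ∣⇒≈0 (ℤ∣.∣ᵤ⇒∣ m∣a)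

  ≈-residue : ∀ .{{_ : NonZero m}} a → a ≈ + (a ℤ÷.%ℕ m)
  ≈-residue a = ≈-byQuotient (a ℤ÷./ℕ m) (begin
    a - + r                      ≡⟨ cong (_- + r) (ℤ÷.a≡a%ℕn+[a/ℕn]*n a m) ⟩
    + r + a ℤ÷./ℕ m * + m - + r  ≡⟨ cancel (+ r) (a ℤ÷./ℕ m * + m) ⟩
    a ℤ÷./ℕ m * + m ∎)
    where
    open ≡-Reasoning
    r = a ℤ÷.%ℕ m
    cancel : ∀ r x → r + x - r ≡ x
    cancel = solve-∀

  ≈⇒∣∸ : ∀ {b c} → b ≤ c → + b ≈ + c → m ∣ c ∸ b
  ≈⇒∣∸ {b} {c} b≤c b≈c =
    subst (m ∣_) (trans (cong ∣_∣ (ℤₚ.m-n≡m⊖n b c)) (ℤₚ.∣⊖∣-≤ b≤c)) (ℤ∣.∣⇒∣ᵤ (divides-difference b≈c))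

  ∣∧<⇒≡0 : ∀ .{{_ : NonZero m}} {x} → m ∣ x → x < m → x ≡ 0
  ∣∧<⇒≡0 {x} m∣x x<m = trans (sym (m<n⇒m%n≡m x<m)) (n∣m⇒m%n≡0 x m m∣x)

  ≤∧≈⇒≡ : ∀ .{{_ : NonZero m}} {b c} → b ≤ c → c < m → + b ≈ + c → b ≡ c
  ≤∧≈⇒≡ {b} {c} b≤c c<m b≈c =
    ℕₚ.≤-antisym b≤c (ℕₚ.m∸n≡0⇒m≤n (∣∧<⇒≡0 (≈⇒∣∸ b≤c b≈c) (ℕₚ.≤-<-trans (ℕₚ.m∸n≤m c b) c<m)))

  ≈-residue-unique : ∀ .{{_ : NonZero m}} {b c} → b < m → c < m → + b ≈ + c → b ≡ c
  ≈-residue-unique {b} {c} b<m c<m b≈c with ℕₚ.≤-total b c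
  ... | inj₁ b≤c = ≤∧≈⇒≡ b≤c c<m b≈c
  ... | inj₂ c≤b = sym (≤∧≈⇒≡ c≤b b<m (≈-sym b≈c))

module PolynomialAlgebra where

  open import Data.Integer using (_+_; _-_; _*_)

  X^-diag : ∀ n → X^ n n ≡ + 1
  X^-diag n with n ℕ.≟ n
  ... | yes _ = refl
  ... | no n≢n = ⊥-elim (n≢n refl)

  X^-off : ∀ {n k} → k ≢ n → X^ n k ≡ + 0
  X^-off {n} {k} k≢n with k ℕ.≟ n
  ... | yes k≡n = ⊥-elim (k≢n k≡n)
  ... | no _ = refl

  xmul-≗ : ∀ {P Q} → P ≗ Q → xmul P ≗ xmul Q
  xmul-≗ P≗Q zero = refl
  xmul-≗ P≗Q (suc k) = P≗Q k

  xmul-X^ : ∀ n → xmul (X^ n) ≗ X^ (suc n)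
  xmul-X^ n zero = sym (X^-off {suc n} {0} λ ())
  xmul-X^ n (suc k) with k ℕ.≟ n
  ... | yes refl = sym (X^-diag (suc k))
  ... | no k≢n = sym (X^-off λ eq → k≢n (ℕₚ.suc-injective eq))

  xmul-+ₚ : ∀ P Q → xmul (P +ₚ Q) ≗ xmul P +ₚ xmul Q
  xmul-+ₚ P Q zero = refl
  xmul-+ₚ P Q (suc k) = refl

  xmul-−ₚ : ∀ P Q → xmul (P −ₚ Q) ≗ xmul P −ₚ xmul Q
  xmul-−ₚ P Q zero = refl
  xmul-−ₚ P Q (suc k) = refl

  xmul-· : ∀ c P → xmul (c · P) ≗ c · xmul P
  xmul-· c P zero = sym (ℤₚ.*-zeroʳ c)
  xmul-· c P (suc k) = refl

  +ₚ-zero· : ∀ P Q → P +ₚ (+ 0) · Q ≗ P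
  +ₚ-zero· P Q k = ℤₚ.+-identityʳ (P k)

  shift : ℕ → Poly → Poly
  shift zero P = P
  shift (suc a) P = xmul (shift a P)

  shift-≗ : ∀ a {P Q} → P ≗ Q → shift a P ≗ shift a Q
  shift-≗ zero P≗Q = P≗Q
  shift-≗ (suc a) P≗Q = xmul-≗ (shift-≗ a P≗Q)

  shift-+ₚ : ∀ a P Q → shift a (P +ₚ Q) ≗ shift a P +ₚ shift a Q
  shift-+ₚ zero P Q k = refl
  shift-+ₚ (suc a) P Q k = trans (xmul-≗ (shift-+ₚ a P Q) k) (xmul-+ₚ (shift a P) (shift a Q) k)

  shift-−ₚ : ∀ a P Q → shift a (P −ₚ Q) ≗ shift a P −ₚ shift a Q
  shift-−ₚ zero P Q k = refl
  shift-−ₚ (suc a) P Q k = trans (xmul-≗ (shift-−ₚ a P Q) k) (xmul-−ₚ (shift a P) (shift a Q) k)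

  shift-· : ∀ a c P → shift a (c · P) ≗ c · shift a P
  shift-· zero c P k = refl
  shift-· (suc a) c P k = trans (xmul-≗ (shift-· a c P) k) (xmul-· c (shift a P) k)

  shift-xmul : ∀ a P → shift a (xmul P) ≗ shift (suc a) P
  shift-xmul zero P k = refl
  shift-xmul (suc a) P = xmul-≗ (shift-xmul a P)

  shift-X^ : ∀ a n → shift a (X^ n) ≗ X^ (a ℕ.+ n)
  shift-X^ zero n k = refl
  shift-X^ (suc a) n k = trans (xmul-≗ (shift-X^ a n) k) (xmul-X^ (a ℕ.+ n) k)

  shift-≤ : ∀ a P {k} → a ≤ k → shift a P k ≡ P (k ∸ a)
  shift-≤ zero P _ = refl
  shift-≤ (suc a) P (s≤s a≤k) = shift-≤ a P a≤k

  shift-> : ∀ a P {k} → k < a → shift a P k ≡ + 0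
  shift-> (suc a) P {zero} _ = refl
  shift-> (suc a) P {suc k} (s≤s k<a) = shift-> a P k<a

  conv-X^-below : ∀ a q k i → i < a → conv (X^ a) q k i ≡ + 0
  conv-X^-below a q k zero 0<a = cong (_* q k) (X^-off λ 0≡a → ℕₚ.<-irrefl 0≡a 0<a)
  conv-X^-below a q k (suc i) i<a =
    cong₂ (λ u v → u + v * q (k ∸ suc i))
          (conv-X^-below a q k i (ℕₚ.<-trans (ℕₚ.n<1+n i) i<a))
          (X^-off λ i≡a → ℕₚ.<-irrefl i≡a i<a)

  conv-X^-above : ∀ a q k i → a ≤ i → conv (X^ a) q k i ≡ q (k ∸ a)
  conv-X^-above zero q k zero _ = ℤₚ.*-identityˡ (q k)
  conv-X^-above a q k (suc i) a≤1+i with a ℕ.≟ suc i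
  ... | yes refl = begin
    conv (X^ (suc i)) q k i + X^ (suc i) (suc i) * q (k ∸ suc i)
      ≡⟨ cong₂ (λ u v → u + v * q (k ∸ suc i)) (conv-X^-below (suc i) q k i ℕₚ.≤-refl) (X^-diag (suc i)) ⟩
    + 0 + + 1 * q (k ∸ suc i)
      ≡⟨ trans (ℤₚ.+-identityˡ _) (ℤₚ.*-identityˡ _) ⟩
    q (k ∸ suc i) ∎
    where open ≡-Reasoning
  ... | no a≢1+i = begin
    conv (X^ a) q k i + X^ a (suc i) * q (k ∸ suc i)
      ≡⟨ cong₂ (λ u v → u + v * q (k ∸ suc i))
               (conv-X^-above a q k i (ℕₚ.≤-pred (ℕₚ.≤∧≢⇒< a≤1+i a≢1+i)))
               (X^-off λ eq → a≢1+i (sym eq)) ⟩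
    q (k ∸ a) + + 0 * q (k ∸ suc i)
      ≡⟨ ℤₚ.+-identityʳ _ ⟩
    q (k ∸ a) ∎
    where open ≡-Reasoning

  X^⊗≗shift : ∀ a q → X^ a ⊗ q ≗ shift a q
  X^⊗≗shift a q k with a ℕ.≤? k
  ... | yes a≤k = trans (conv-X^-above a q k k a≤k) (sym (shift-≤ a q a≤k))
  ... | no a≰k = trans (conv-X^-below a q k k (ℕₚ.≰⇒> a≰k)) (sym (shift-> a q (ℕₚ.≰⇒> a≰k)))

  ⊗-identityʳ : ∀ p → p ⊗ X^ 0 ≗ p
  ⊗-identityʳ p zero = ℤₚ.*-identityʳ (p 0)
  ⊗-identityʳ p (suc k) = begin
    conv p (X^ 0) (suc k) k + p (suc k) * X^ 0 (k ∸ k)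
      ≡⟨ cong₂ (λ u v → u + p (suc k) * X^ 0 v) (below k ℕₚ.≤-refl) (ℕₚ.n∸n≡0 k) ⟩
    + 0 + p (suc k) * + 1
      ≡⟨ trans (ℤₚ.+-identityˡ _) (ℤₚ.*-identityʳ _) ⟩
    p (suc k) ∎
    where
    open ≡-Reasoning
    below : ∀ i → i ≤ k → conv p (X^ 0) (suc k) i ≡ + 0
    below zero _ = ℤₚ.*-zeroʳ (p 0)
    below (suc i) i<k = begin
      conv p (X^ 0) (suc k) i + p (suc i) * X^ 0 (k ∸ i)
        ≡⟨ cong₂ (λ u v → u + p (suc i) * v) (below i (ℕₚ.<⇒≤ i<k))
                 (X^-off λ k∸i≡0 → ℕₚ.<⇒≱ i<k (ℕₚ.m∸n≡0⇒m≤n k∸i≡0)) ⟩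
      + 0 + p (suc i) * + 0
        ≡⟨ trans (ℤₚ.+-identityˡ _) (ℤₚ.*-zeroʳ (p (suc i))) ⟩
      + 0 ∎

open PolynomialAlgebra

module Recurrence where

  open import Data.Integer using (_+_; _-_; _*_)

  [r+q*d]%d≡r : ∀ {r} q d .{{_ : NonZero d}} → r < d → (r ℕ.+ q ℕ.* d) % d ≡ r
  [r+q*d]%d≡r {r} q d r<d = trans ([m+kn]%n≡m%n r q d) (m<n⇒m%n≡m r<d)

  [r+q*d]/d≡q : ∀ {r} q d .{{_ : NonZero d}} → r < d → (r ℕ.+ q ℕ.* d) / d ≡ q
  [r+q*d]/d≡q {r} q d r<d = trans (+-distrib-/-∣ʳ r (n∣m*n q)) (cong₂ ℕ._+_ (m<n⇒m/n≡0 r<d) (m*n/n≡m q d))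

  fall-∣ : ∀ {i k} x → i < k → x ∸ i ∣ fall x k
  fall-∣ {zero} {suc k} x _ = m∣m*n (fall (x ∸ 1) k)
  fall-∣ {suc i} {suc k} x (s≤s i<k) =
    ∣n⇒∣m*n x (subst (_∣ fall (x ∸ 1) k) (ℕₚ.∸-+-assoc x 1 i) (fall-∣ (x ∸ 1) i<k))

  fall[a+q*d]%d : ∀ a q d .{{_ : NonZero d}} → fall (a ℕ.+ q ℕ.* d) a % d ≡ a ! % d
  fall[a+q*d]%d zero q d = refl
  fall[a+q*d]%d (suc a) q d = begin
    (suc a ℕ.+ q ℕ.* d) ℕ.* fall (a ℕ.+ q ℕ.* d) a % d
      ≡⟨ %-distribˡ-* (suc a ℕ.+ q ℕ.* d) _ d ⟩
    ((suc a ℕ.+ q ℕ.* d) % d ℕ.* (fall (a ℕ.+ q ℕ.* d) a % d)) % d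
      ≡⟨ cong₂ (λ x y → (x ℕ.* y) % d) ([m+kn]%n≡m%n (suc a) q d) (fall[a+q*d]%d a q d) ⟩
    (suc a % d ℕ.* (a ! % d)) % d
      ≡⟨ %-distribˡ-* (suc a) (a !) d ⟨
    suc a ! % d ∎
    where open ≡-Reasoning

  module _ (m : ℕ) where
    open Congruence m

    H≈ₚ-byRecurrence : ∀ d (G : ℕ → Poly) → 1 ≤ d →
      (∀ n → n < d → X^ n ≈ₚ G n) →
      (∀ n → d ≤ n → xmul (G (n ∸ 1)) +ₚ (+ fall (n ∸ 1) (d ∸ 1)) · G (n ∸ d) ≈ₚ G n) →
      ∀ n → H d n ≈ₚ G n
    H≈ₚ-byRecurrence d G 1≤d initial recurrence n = Hfuel≈ₚ n n ℕₚ.≤-refl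
      where
      Hfuel≈ₚ : ∀ f n → n ≤ f → Hfuel d f n ≈ₚ G n
      Hfuel≈ₚ zero zero _ = initial 0 1≤d
      Hfuel≈ₚ (suc f) n n≤1+f with n <? d
      ... | yes n<d = initial n n<d
      ... | no n≮d = begin
        xmul (Hfuel d f (n ∸ 1)) +ₚ (+ fall (n ∸ 1) (d ∸ 1)) · Hfuel d f (n ∸ d)
          ≈⟨ +ₚ-cong (xmul-cong (Hfuel≈ₚ f (n ∸ 1) n∸1≤f))
                     (·-congˡ (+ fall (n ∸ 1) (d ∸ 1)) (Hfuel≈ₚ f (n ∸ d) n∸d≤f)) ⟩
        xmul (G (n ∸ 1)) +ₚ (+ fall (n ∸ 1) (d ∸ 1)) · G (n ∸ d)
          ≈⟨ recurrence n (ℕₚ.≮⇒≥ n≮d) ⟩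
        G n ∎
        where
        open ≈ₚ-Reasoning
        n∸1≤f : n ∸ 1 ≤ f
        n∸1≤f = ℕₚ.∸-monoˡ-≤ 1 n≤1+f
        n∸d≤f : n ∸ d ≤ f
        n∸d≤f = ℕₚ.≤-trans (ℕₚ.∸-monoʳ-≤ n 1≤d) n∸1≤f

  module _ (e : ℕ) (G : ℕ → Poly) where
    private d = suc e
    open Congruence d

    H≈ₚ-byResidue :
      (∀ n → n ≤ e → X^ n ≈ₚ G n) →
      (∀ r q → r < e → xmul (G (r ℕ.+ q ℕ.* d)) ≈ₚ G (suc r ℕ.+ q ℕ.* d)) →
      (∀ q → xmul (G (e ℕ.+ q ℕ.* d)) +ₚ (+ (e !)) · G (q ℕ.* d) ≈ₚ G (suc q ℕ.* d)) →
      ∀ n → H d n ≈ₚ G n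
    H≈ₚ-byResidue initial step wrap =
      H≈ₚ-byRecurrence d d G (s≤s z≤n) (λ n → initial n ∘ ℕₚ.≤-pred) recurrence
      where
      Recurrence : ℕ → Set
      Recurrence n = xmul (G (n ∸ 1)) +ₚ (+ fall (n ∸ 1) e) · G (n ∸ d) ≈ₚ G n

      byResidue : ∀ r q → r < d → d ≤ r ℕ.+ q ℕ.* d → Recurrence (r ℕ.+ q ℕ.* d)
      byResidue (suc r) q (s≤s r<e) _ = begin
        xmul (G (r ℕ.+ q ℕ.* d)) +ₚ (+ fall (r ℕ.+ q ℕ.* d) e) · G (suc r ℕ.+ q ℕ.* d ∸ d)
          ≈⟨ +ₚ-congˡ (xmul (G (r ℕ.+ q ℕ.* d))) (·-congʳ (∣⇒≈0 d∣fall) (G (suc r ℕ.+ q ℕ.* d ∸ d))) ⟩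
        xmul (G (r ℕ.+ q ℕ.* d)) +ₚ (+ 0) · G (suc r ℕ.+ q ℕ.* d ∸ d)
          ≈⟨ ≗⇒≈ₚ (+ₚ-zero· (xmul (G (r ℕ.+ q ℕ.* d))) (G (suc r ℕ.+ q ℕ.* d ∸ d))) ⟩
        xmul (G (r ℕ.+ q ℕ.* d))
          ≈⟨ step r q r<e ⟩
        G (suc r ℕ.+ q ℕ.* d) ∎
        where
        open ≈ₚ-Reasoning
        d∣fall : d ∣ fall (r ℕ.+ q ℕ.* d) e
        d∣fall = ∣-trans (n∣m*n q)
                   (subst (_∣ fall (r ℕ.+ q ℕ.* d) e) (ℕₚ.m+n∸m≡n r (q ℕ.* d)) (fall-∣ (r ℕ.+ q ℕ.* d) r<e))
      byResidue zero (suc q) _ _ = begin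
        xmul (G (e ℕ.+ q ℕ.* d)) +ₚ (+ fall (e ℕ.+ q ℕ.* d) e) · G (e ℕ.+ q ℕ.* d ∸ e)
          ≈⟨ +ₚ-congˡ (xmul (G (e ℕ.+ q ℕ.* d)))
                     (·-cong (%≡⇒≈ (fall (e ℕ.+ q ℕ.* d) e) (e !) (fall[a+q*d]%d e q d))
                             (≗⇒≈ₚ (λ k → cong (λ n → G n k) (ℕₚ.m+n∸m≡n e (q ℕ.* d))))) ⟩
        xmul (G (e ℕ.+ q ℕ.* d)) +ₚ (+ (e !)) · G (q ℕ.* d)
          ≈⟨ wrap q ⟩
        G (suc q ℕ.* d) ∎
        where open ≈ₚ-Reasoning

      recurrence : ∀ n → d ≤ n → Recurrence n
      recurrence n d≤n = subst Recurrence (sym n≡r+q*d)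
        (byResidue (n % d) (n / d) (m%n<n n d) (subst (d ≤_) n≡r+q*d d≤n))
        where n≡r+q*d = m≡m%n+[m/n]*n n d

open Recurrence

module CompositeModulus where

  open import Data.Integer using (_+_; _-_; _*_)

  ∣n! : ∀ {a n} → 0 < a → a ≤ n → a ∣ n !
  ∣n! {suc a} _ a≤n = ∣-trans (m∣m*n (a !)) (m≤n⇒m!∣n! a≤n)

  *∣n! : ∀ {a b n} → 0 < a → a < b → b ≤ n → a ℕ.* b ∣ n !
  *∣n! {a} {suc b} 0<a (s≤s a≤b) 1+b≤n =
    ∣-trans (subst (_∣ suc b ℕ.* b !) (ℕₚ.*-comm (suc b) a) (*-monoʳ-∣ (suc b) (∣n! 0<a a≤b)))
            (m≤n⇒m!∣n! 1+b≤n)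

  -- A divisor and its cofactor are distinct factors of (d - 1)!, except for d = a * a,
  -- where a and 2a are, once a > 2.
  composite>4⇒∣[d∸1]! : ∀ {d} → Composite d → 4 < d → d ∣ (d ∸ 1) !
  composite>4⇒∣[d∸1]! {suc d} (composite {a} a<d (divides q d≡q*a)) 4<d with ℕₚ.<-cmp a q
  ... | tri< a<q _ _ = subst (_∣ d !) (trans (ℕₚ.*-comm a q) (sym d≡q*a)) (*∣n! 0<a a<q (ℕₚ.≤-pred q<1+d))
    where
    0<a = ℕₚ.<-trans (s≤s z≤n) (ℕ.nonTrivial⇒n>1 a)
    0<q = ℕₚ.<-trans 0<a a<q
    q<1+d : q < suc d
    q<1+d = subst (q <_) (sym d≡q*a) (ℕₚ.m<m*n q a ⦃ ℕ.>-nonZero 0<q ⦄ (ℕ.nonTrivial⇒n>1 a))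
  ... | tri> _ _ q<a = subst (_∣ d !) (sym d≡q*a) (*∣n! 0<q q<a (ℕₚ.≤-pred a<d))
    where
    0<q : 0 < q
    0<q = ℕₚ.n≢0⇒n>0 λ q≡0 → ℕₚ.1+n≢0 (trans d≡q*a (cong (ℕ._* a) q≡0))
  ... | tri≈ _ refl _ = ∣-trans (subst (_∣ a ℕ.* (2 ℕ.* a)) (sym d≡q*a) (*-monoʳ-∣ a (n∣m*n 2)))
                                (*∣n! 0<a a<2a (ℕₚ.≤-pred 2a<1+d))
    where
    0<a = ℕₚ.<-trans (s≤s z≤n) (ℕ.nonTrivial⇒n>1 a)
    a<2a : a < 2 ℕ.* a
    a<2a = ℕₚ.m<m+n a (subst (0 <_) (sym (ℕₚ.+-identityʳ a)) 0<a)
    2<a : 2 < a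
    2<a = ℕₚ.≤∧≢⇒< (ℕ.nonTrivial⇒n>1 a)
            λ 2≡a → ℕₚ.<-irrefl (sym (subst (λ x → suc d ≡ x ℕ.* x) (sym 2≡a) d≡q*a)) 4<d
    2a<1+d : 2 ℕ.* a < suc d
    2a<1+d = subst (2 ℕ.* a <_) (sym d≡q*a) (ℕₚ.*-monoˡ-< a ⦃ ℕ.>-nonZero 0<a ⦄ 2<a)

  module _ (e : ℕ) (composite[1+e] : Composite (suc e)) (4<1+e : 4 < suc e) where
    private d = suc e
    open Congruence d

    H≈ₚX^-composite : ∀ n → H d n ≈ₚ X^ n
    H≈ₚX^-composite = H≈ₚ-byResidue e X^ (λ _ _ → ≗⇒≈ₚ λ _ → refl) step wrap
      where
      step : ∀ r q → r < e → xmul (X^ (r ℕ.+ q ℕ.* d)) ≈ₚ X^ (suc r ℕ.+ q ℕ.* d)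
      step r q _ = ≗⇒≈ₚ (xmul-X^ (r ℕ.+ q ℕ.* d))
      wrap : ∀ q → xmul (X^ (e ℕ.+ q ℕ.* d)) +ₚ (+ (e !)) · X^ (q ℕ.* d) ≈ₚ X^ (suc q ℕ.* d)
      wrap q = begin
        xmul (X^ (e ℕ.+ q ℕ.* d)) +ₚ (+ (e !)) · X^ (q ℕ.* d)
          ≈⟨ +ₚ-congˡ (xmul (X^ (e ℕ.+ q ℕ.* d)))
                      (·-congʳ (∣⇒≈0 (composite>4⇒∣[d∸1]! composite[1+e] 4<1+e)) (X^ (q ℕ.* d))) ⟩
        xmul (X^ (e ℕ.+ q ℕ.* d)) +ₚ (+ 0) · X^ (q ℕ.* d)
          ≈⟨ ≗⇒≈ₚ (λ k → trans (+ₚ-zero· (xmul (X^ (e ℕ.+ q ℕ.* d))) (X^ (q ℕ.* d)) k)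
                               (xmul-X^ (e ℕ.+ q ℕ.* d) k)) ⟩
        X^ (suc q ℕ.* d) ∎
        where open ≈ₚ-Reasoning

open CompositeModulus

module ModulusFour where

  open import Data.Integer using (_+_; _-_; _*_)

  open Congruence 4

  G₄ : ℕ → Poly
  G₄ n = X^ n +ₚ (+ (2 ℕ.* (n / 4))) · X^ (n ∸ 4)

  X^≈ₚG₄ : ∀ n → n < 4 → X^ n ≈ₚ G₄ n
  X^≈ₚG₄ n n<4 = ≗⇒≈ₚ λ k → sym (begin
    X^ n k + + (2 ℕ.* (n / 4)) * X^ (n ∸ 4) k ≡⟨ cong (λ t → X^ n k + + (2 ℕ.* t) * X^ (n ∸ 4) k) (m<n⇒m/n≡0 n<4) ⟩
    X^ n k + + 0                              ≡⟨ ℤₚ.+-identityʳ (X^ n k) ⟩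
    X^ n k ∎)
    where open ≡-Reasoning

  G₄-residue : ∀ r q → r < 4 →
               G₄ (r ℕ.+ q ℕ.* 4) ≗ X^ (r ℕ.+ q ℕ.* 4) +ₚ (+ (2 ℕ.* q)) · X^ (r ℕ.+ q ℕ.* 4 ∸ 4)
  G₄-residue r q r<4 k =
    cong (λ t → X^ (r ℕ.+ q ℕ.* 4) k + + (2 ℕ.* t) * X^ (r ℕ.+ q ℕ.* 4 ∸ 4) k) ([r+q*d]/d≡q q 4 r<4)

  -- For q = 0 both sides vanish; otherwise r + q * 4 ≥ 4, so the exponents agree.
  ·X^-suc∸4 : ∀ r q → (+ (2 ℕ.* q)) · X^ (suc (r ℕ.+ q ℕ.* 4 ∸ 4))
                    ≗ (+ (2 ℕ.* q)) · X^ (suc r ℕ.+ q ℕ.* 4 ∸ 4)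
  ·X^-suc∸4 r zero k = refl
  ·X^-suc∸4 r (suc q) k =
    cong (λ i → + (2 ℕ.* suc q) * X^ i k)
         (sym (ℕₚ.+-∸-assoc 1 (ℕₚ.≤-trans (ℕₚ.m≤m+n 4 (q ℕ.* 4)) (ℕₚ.m≤n+m _ r))))

  xmul-G₄ : ∀ r q → r < 4 →
            xmul (G₄ (r ℕ.+ q ℕ.* 4)) ≗ X^ (suc r ℕ.+ q ℕ.* 4) +ₚ (+ (2 ℕ.* q)) · X^ (suc r ℕ.+ q ℕ.* 4 ∸ 4)
  xmul-G₄ r q r<4 k = begin
    xmul (G₄ n) k                                           ≡⟨ xmul-≗ (G₄-residue r q r<4) k ⟩
    xmul (X^ n +ₚ c · X^ (n ∸ 4)) k                         ≡⟨ xmul-+ₚ (X^ n) (c · X^ (n ∸ 4)) k ⟩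
    xmul (X^ n) k + xmul (c · X^ (n ∸ 4)) k                 ≡⟨ cong₂ _+_ (xmul-X^ n k) (xmul-· c (X^ (n ∸ 4)) k) ⟩
    X^ (suc n) k + c * xmul (X^ (n ∸ 4)) k                  ≡⟨ cong (λ t → X^ (suc n) k + c * t) (xmul-X^ (n ∸ 4) k) ⟩
    X^ (suc n) k + c * X^ (suc (n ∸ 4)) k                   ≡⟨ cong (λ t → X^ (suc n) k + t) (·X^-suc∸4 r q k) ⟩
    X^ (suc n) k + c * X^ (suc n ∸ 4) k                     ∎
    where
    open ≡-Reasoning
    n = r ℕ.+ q ℕ.* 4
    c = + (2 ℕ.* q)

  H₄≈ₚG₄ : ∀ n → H 4 n ≈ₚ G₄ n
  H₄≈ₚG₄ = H≈ₚ-byResidue 3 G₄ (λ n → X^≈ₚG₄ n ∘ s≤s) step wrap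
    where
    step : ∀ r q → r < 3 → xmul (G₄ (r ℕ.+ q ℕ.* 4)) ≈ₚ G₄ (suc r ℕ.+ q ℕ.* 4)
    step r q r<3 = ≗⇒≈ₚ λ k →
      trans (xmul-G₄ r q (ℕₚ.m<n⇒m<1+n r<3) k) (sym (G₄-residue (suc r) q (s≤s r<3) k))
    wrap : ∀ q → xmul (G₄ (3 ℕ.+ q ℕ.* 4)) +ₚ (+ 6) · G₄ (q ℕ.* 4) ≈ₚ G₄ (suc q ℕ.* 4)
    wrap q = mk≈ₚ λ k → ≈-byQuotient (X^ (q ℕ.* 4) k + + 3 * + q * X^ (q ℕ.* 4 ∸ 4) k) (difference-at k)
      where
      difference-at : ∀ k → xmul (G₄ (3 ℕ.+ q ℕ.* 4)) k + + 6 * G₄ (q ℕ.* 4) k - G₄ (suc q ℕ.* 4) k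
                          ≡ (X^ (q ℕ.* 4) k + + 3 * + q * X^ (q ℕ.* 4 ∸ 4) k) * + 4
      difference-at k = begin
        xmul (G₄ (3 ℕ.+ q ℕ.* 4)) k + + 6 * G₄ (q ℕ.* 4) k - G₄ (suc q ℕ.* 4) k
          ≡⟨ cong₂ (λ u v → u + + 6 * v - G₄ (suc q ℕ.* 4) k)
                   (xmul-G₄ 3 q ℕₚ.≤-refl k) (G₄-residue 0 q (s≤s z≤n) k) ⟩
        N + + (2 ℕ.* q) * Y + + 6 * (Y + + (2 ℕ.* q) * Z) - G₄ (suc q ℕ.* 4) k
          ≡⟨ cong (λ t → N + + (2 ℕ.* q) * Y + + 6 * (Y + + (2 ℕ.* q) * Z) - t)
                  (G₄-residue 0 (suc q) (s≤s z≤n) k) ⟩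
        N + + (2 ℕ.* q) * Y + + 6 * (Y + + (2 ℕ.* q) * Z) - (N + + (2 ℕ.* suc q) * Y)
          ≡⟨ cong₂ (λ u v → N + u * Y + + 6 * (Y + u * Z) - (N + + 2 * v * Y))
                   (ℤₚ.pos-* 2 q) (ℤₚ.pos-+ 1 q) ⟩
        N + + 2 * + q * Y + + 6 * (Y + + 2 * + q * Z) - (N + + 2 * (+ 1 + + q) * Y)
          ≡⟨ difference N Y Z (+ q) ⟩
        (Y + + 3 * + q * Z) * + 4 ∎
        where
        open ≡-Reasoning
        N = X^ (suc q ℕ.* 4) k
        Y = X^ (q ℕ.* 4) k
        Z = X^ (q ℕ.* 4 ∸ 4) k
        difference : ∀ N Y Z q → N + + 2 * q * Y + + 6 * (Y + + 2 * q * Z) - (N + + 2 * (+ 1 + q) * Y)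
                               ≡ (Y + + 3 * q * Z) * + 4
        difference = solve-∀

  2*≈2*[%2] : ∀ a → + (2 ℕ.* a) ≈ + (2 ℕ.* (a % 2))
  2*≈2*[%2] a = %≡⇒≈ (2 ℕ.* a) (2 ℕ.* (a % 2)) (begin
    2 ℕ.* a % 4                                ≡⟨ cong (λ t → 2 ℕ.* t % 4) (m≡m%n+[m/n]*n a 2) ⟩
    2 ℕ.* (a % 2 ℕ.+ a / 2 ℕ.* 2) % 4          ≡⟨ cong (_% 4) (double (a % 2) (a / 2)) ⟩
    (2 ℕ.* (a % 2) ℕ.+ a / 2 ℕ.* 4) % 4        ≡⟨ [m+kn]%n≡m%n (2 ℕ.* (a % 2)) (a / 2) 4 ⟩
    2 ℕ.* (a % 2) % 4 ∎)
    where
    open ≡-Reasoning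
    double : ∀ r q → 2 ℕ.* (r ℕ.+ q ℕ.* 2) ≡ 2 ℕ.* r ℕ.+ q ℕ.* 4
    double = ℕ-Solver.solve-∀

  const≗·X^0 : ∀ c → const c ≗ c · X^ 0
  const≗·X^0 c zero = sym (ℤₚ.*-identityʳ c)
  const≗·X^0 c (suc k) = sym (ℤₚ.*-zeroʳ c)

  parity-form : ∀ n → X^ n +ₚ (+ (2 ℕ.* ((n / 4) % 2))) · X^ (n ∸ 4)
                    ≗ X^ (n ∸ 4 ℕ.* ((n / 4) % 2)) ⊗ ((X^ 4 +ₚ const (+ 2)) ^ₚ ((n / 4) % 2))
  parity-form n with (n / 4) % 2 in ε≡ | m%n<n (n / 4) 2
  ... | 0 | _ = λ k → trans (ℤₚ.+-identityʳ (X^ n k)) (sym (⊗-identityʳ (X^ n) k))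
  ... | 1 | _ = λ k → sym (begin
    (X^ (n ∸ 4) ⊗ ((X^ 4 +ₚ const (+ 2)) ⊗ X^ 0)) k
      ≡⟨ X^⊗≗shift (n ∸ 4) _ k ⟩
    shift (n ∸ 4) ((X^ 4 +ₚ const (+ 2)) ⊗ X^ 0) k
      ≡⟨ shift-≗ (n ∸ 4) (⊗-identityʳ (X^ 4 +ₚ const (+ 2))) k ⟩
    shift (n ∸ 4) (X^ 4 +ₚ const (+ 2)) k
      ≡⟨ shift-+ₚ (n ∸ 4) (X^ 4) (const (+ 2)) k ⟩
    shift (n ∸ 4) (X^ 4) k + shift (n ∸ 4) (const (+ 2)) k
      ≡⟨ cong (λ t → shift (n ∸ 4) (X^ 4) k + t)
              (trans (shift-≗ (n ∸ 4) (const≗·X^0 (+ 2)) k) (shift-· (n ∸ 4) (+ 2) (X^ 0) k)) ⟩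
    shift (n ∸ 4) (X^ 4) k + + 2 * shift (n ∸ 4) (X^ 0) k
      ≡⟨ cong₂ (λ u v → u + + 2 * v) (shift-X^ (n ∸ 4) 4 k) (shift-X^ (n ∸ 4) 0 k) ⟩
    X^ (n ∸ 4 ℕ.+ 4) k + + 2 * X^ (n ∸ 4 ℕ.+ 0) k
      ≡⟨ cong₂ (λ i j → X^ i k + + 2 * X^ j k) (ℕₚ.m∸n+n≡m 4≤n) (ℕₚ.+-identityʳ (n ∸ 4)) ⟩
    X^ n k + + 2 * X^ (n ∸ 4) k ∎)
    where
    open ≡-Reasoning
    4≤n : 4 ≤ n
    4≤n = m/n≢0⇒n≤m λ n/4≡0 → 0≢1 (trans (cong (_% 2) (sym n/4≡0)) ε≡)
      where 0≢1 : 0 ≢ 1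
            0≢1 ()
  ... | suc (suc _) | s≤s (s≤s ())

  H₄≈ₚparity-form : ∀ n → H 4 n ≈ₚ X^ (n ∸ 4 ℕ.* ((n / 4) % 2)) ⊗ ((X^ 4 +ₚ const (+ 2)) ^ₚ ((n / 4) % 2))
  H₄≈ₚparity-form n = begin
    H 4 n
      ≈⟨ H₄≈ₚG₄ n ⟩
    G₄ n
      ≈⟨ +ₚ-congˡ (X^ n) (·-congʳ (2*≈2*[%2] (n / 4)) (X^ (n ∸ 4))) ⟩
    X^ n +ₚ (+ (2 ℕ.* ((n / 4) % 2))) · X^ (n ∸ 4)
      ≈⟨ ≗⇒≈ₚ (parity-form n) ⟩
    X^ (n ∸ 4 ℕ.* ((n / 4) % 2)) ⊗ ((X^ 4 +ₚ const (+ 2)) ^ₚ ((n / 4) % 2)) ∎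
    where open ≈ₚ-Reasoning

open ModulusFour

module Frobenius where

  open import Data.Integer using (_+_; _-_; _*_)

  mul[x-1] : Poly → Poly
  mul[x-1] P = xmul P −ₚ P

  mul[x-1]-≗ : ∀ {P Q} → P ≗ Q → mul[x-1] P ≗ mul[x-1] Q
  mul[x-1]-≗ P≗Q k = cong₂ _-_ (xmul-≗ P≗Q k) (P≗Q k)

  mul[x-1]^ : ℕ → Poly → Poly
  mul[x-1]^ zero P = P
  mul[x-1]^ (suc m) P = mul[x-1]^ m (mul[x-1] P)

  mul[x-1]^-suc : ∀ m P → mul[x-1]^ (suc m) P ≗ mul[x-1] (mul[x-1]^ m P)
  mul[x-1]^-suc zero P k = refl
  mul[x-1]^-suc (suc m) P = mul[x-1]^-suc m (mul[x-1] P)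

  [x-1]⊗≗mul[x-1] : ∀ P → (X^ 1 −ₚ X^ 0) ⊗ P ≗ mul[x-1] P
  [x-1]⊗≗mul[x-1] P zero = negate (P 0)
    where negate : ∀ a → (+ 0 - + 1) * a ≡ + 0 - a
          negate = solve-∀
  [x-1]⊗≗mul[x-1] P (suc k) = trans (conv-suc k) (ℤₚ.+-comm (- P (suc k)) (P k))
    where
    conv-suc : ∀ i → conv (X^ 1 −ₚ X^ 0) P (suc k) (suc i) ≡ - P (suc k) + P k
    conv-suc zero = cong₂ _+_ (negate (P (suc k))) (ℤₚ.*-identityˡ (P k))
      where negate : ∀ a → (+ 0 - + 1) * a ≡ - a
            negate = solve-∀
    conv-suc (suc i) = trans (cong (_+ + 0 * P (k ∸ suc i)) (conv-suc i)) (ℤₚ.+-identityʳ _)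

  [x-1]^-+ : ∀ a b → (X^ 1 −ₚ X^ 0) ^ₚ (a ℕ.+ b) ≗ mul[x-1]^ a ((X^ 1 −ₚ X^ 0) ^ₚ b)
  [x-1]^-+ zero b k = refl
  [x-1]^-+ (suc a) b k = begin
    ((X^ 1 −ₚ X^ 0) ⊗ ((X^ 1 −ₚ X^ 0) ^ₚ (a ℕ.+ b))) k   ≡⟨ [x-1]⊗≗mul[x-1] _ k ⟩
    mul[x-1] ((X^ 1 −ₚ X^ 0) ^ₚ (a ℕ.+ b)) k            ≡⟨ mul[x-1]-≗ ([x-1]^-+ a b) k ⟩
    mul[x-1] (mul[x-1]^ a ((X^ 1 −ₚ X^ 0) ^ₚ b)) k      ≡⟨ mul[x-1]^-suc a _ k ⟨
    mul[x-1]^ (suc a) ((X^ 1 −ₚ X^ 0) ^ₚ b) k ∎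
    where open ≡-Reasoning

  sum≤ : ℕ → (ℕ → ℤ) → ℤ
  sum≤ zero f = f 0
  sum≤ (suc m) f = sum≤ m f + f (suc m)

  sum≤-cong : ∀ m {f g} → (∀ j → f j ≡ g j) → sum≤ m f ≡ sum≤ m g
  sum≤-cong zero f≗g = f≗g 0
  sum≤-cong (suc m) f≗g = cong₂ _+_ (sum≤-cong m f≗g) (f≗g (suc m))

  sum≤-suc : ∀ m f → sum≤ (suc m) f ≡ f 0 + sum≤ m (f ∘ suc)
  sum≤-suc zero f = refl
  sum≤-suc (suc m) f = trans (cong (_+ f (suc (suc m))) (sum≤-suc m f))
                             (ℤₚ.+-assoc (f 0) (sum≤ m (f ∘ suc)) (f (suc (suc m))))

  sum≤-− : ∀ m f g → sum≤ m (λ j → f j - g j) ≡ sum≤ m f - sum≤ m g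
  sum≤-− zero f g = refl
  sum≤-− (suc m) f g = trans (cong (_+ (f (suc m) - g (suc m))) (sum≤-− m f g))
                             (interchange (sum≤ m f) (sum≤ m g) (f (suc m)) (g (suc m)))
    where interchange : ∀ a b c d → (a - b) + (c - d) ≡ (a + c) - (b + d)
          interchange = solve-∀

  module _ (m : ℕ) where
    open Congruence m

    sum≤-≈head : ∀ i g → (∀ j → j < i → g (suc j) ≈ + 0) → sum≤ i g ≈ g 0
    sum≤-≈head zero g _ = ≡⇒≈ refl
    sum≤-≈head (suc i) g tail≈0 = begin
      sum≤ i g + g (suc i)   ≈⟨ +-cong (sum≤-≈head i g (λ j j<i → tail≈0 j (ℕₚ.m<n⇒m<1+n j<i))) (tail≈0 i ℕₚ.≤-refl) ⟩
      g 0 + + 0              ≡⟨ ℤₚ.+-identityʳ (g 0) ⟩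
      g 0 ∎
      where open ≈-Reasoning

  -- sbinom m j is the coefficient of x^j in (x - 1)^m.
  sbinom : ℕ → ℕ → ℤ
  sbinom zero zero = + 1
  sbinom zero (suc j) = + 0
  sbinom (suc m) zero = - sbinom m zero
  sbinom (suc m) (suc j) = sbinom m j - sbinom m (suc j)

  sbinom-> : ∀ m j → m < j → sbinom m j ≡ + 0
  sbinom-> zero (suc j) _ = refl
  sbinom-> (suc m) (suc j) (s≤s m<j) =
    cong₂ _-_ (sbinom-> m j m<j) (sbinom-> m (suc j) (ℕₚ.m<n⇒m<1+n m<j))

  sbinom-diag : ∀ m → sbinom m m ≡ + 1
  sbinom-diag zero = refl
  sbinom-diag (suc m) = cong₂ _-_ (sbinom-diag m) (sbinom-> m (suc m) (ℕₚ.n<1+n m))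

  sum≤-sbinom-suc : ∀ m (f : ℕ → ℤ) → sum≤ (suc m) (λ j → sbinom (suc m) j * f j)
                          ≡ sum≤ m (λ j → sbinom m j * (f (suc j) - f j))
  sum≤-sbinom-suc m f = begin
    sum≤ (suc m) (λ j → sbinom (suc m) j * f j)
      ≡⟨ sum≤-suc m _ ⟩
    - sbinom m 0 * f 0 + sum≤ m (λ j → (sbinom m j - sbinom m (suc j)) * f (suc j))
      ≡⟨ cong (λ t → - sbinom m 0 * f 0 + t)
              (trans (sum≤-cong m λ j → *-distribʳ-− (f (suc j)) (sbinom m j) _) (sum≤-− m _ _)) ⟩
    - sbinom m 0 * f 0 + (sum≤ m (λ j → sbinom m j * f (suc j)) - B)
      ≡⟨ regroup (sbinom m 0) (f 0) (sum≤ m (λ j → sbinom m j * f (suc j))) B ⟩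
    sum≤ m (λ j → sbinom m j * f (suc j)) - (sbinom m 0 * f 0 + B)
      ≡⟨ cong (λ t → sum≤ m (λ j → sbinom m j * f (suc j)) - t) head+B ⟩
    sum≤ m (λ j → sbinom m j * f (suc j)) - sum≤ m (λ j → sbinom m j * f j)
      ≡⟨ trans (sum≤-cong m λ j → *-distribˡ-− (sbinom m j) (f (suc j)) (f j)) (sum≤-− m _ _) ⟨
    sum≤ m (λ j → sbinom m j * (f (suc j) - f j)) ∎
    where
    open ≡-Reasoning
    B = sum≤ m (λ j → sbinom m (suc j) * f (suc j))
    *-distribʳ-− : ∀ x a b → (a - b) * x ≡ a * x - b * x
    *-distribʳ-− = solve-∀
    *-distribˡ-− : ∀ x a b → x * (a - b) ≡ x * a - x * b
    *-distribˡ-− = solve-∀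
    regroup : ∀ x y a b → - x * y + (a - b) ≡ a - (x * y + b)
    regroup = solve-∀
    head+B : sbinom m 0 * f 0 + B ≡ sum≤ m (λ j → sbinom m j * f j)
    head+B = begin
      sbinom m 0 * f 0 + B
        ≡⟨ sum≤-suc m _ ⟨
      sum≤ (suc m) (λ j → sbinom m j * f j)
        ≡⟨ cong (λ b → sum≤ m (λ j → sbinom m j * f j) + b * f (suc m)) (sbinom-> m (suc m) (ℕₚ.n<1+n m)) ⟩
      sum≤ m (λ j → sbinom m j * f j) + + 0 * f (suc m)
        ≡⟨ ℤₚ.+-identityʳ _ ⟩
      sum≤ m (λ j → sbinom m j * f j) ∎

  mul[x-1]^-expansion : ∀ m Q k → mul[x-1]^ m Q k ≡ sum≤ m (λ j → sbinom m j * shift j Q k)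
  mul[x-1]^-expansion zero Q k = sym (ℤₚ.*-identityˡ (Q k))
  mul[x-1]^-expansion (suc m) Q k = begin
    mul[x-1]^ m (mul[x-1] Q) k
      ≡⟨ mul[x-1]^-expansion m (mul[x-1] Q) k ⟩
    sum≤ m (λ j → sbinom m j * shift j (mul[x-1] Q) k)
      ≡⟨ sum≤-cong m (λ j → cong (sbinom m j *_)
                            (trans (shift-−ₚ j (xmul Q) Q k) (cong (_- shift j Q k) (shift-xmul j Q k)))) ⟩
    sum≤ m (λ j → sbinom m j * (shift (suc j) Q k - shift j Q k))
      ≡⟨ sum≤-sbinom-suc m (λ j → shift j Q k) ⟨
    sum≤ (suc m) (λ j → sbinom (suc m) j * shift j Q k) ∎
    where open ≡-Reasoning

  sbinom-absorb : ∀ m j → + suc j * sbinom (suc m) (suc j) ≡ + suc m * sbinom m j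
  sbinom-absorb zero zero = refl
  sbinom-absorb zero (suc j) = ℤₚ.*-zeroʳ (+ suc (suc j))
  sbinom-absorb (suc m) zero = begin
    + 1 * (- b - sbinom (suc m) 1)     ≡⟨ step b (sbinom (suc m) 1) ⟩
    - b - + 1 * sbinom (suc m) 1       ≡⟨ cong (λ t → - b - t) (sbinom-absorb m zero) ⟩
    - b - + suc m * b                  ≡⟨ collect b (+ suc m) ⟩
    (+ 1 + + suc m) * - b              ≡⟨ cong (_* - b) (ℤₚ.pos-+ 1 (suc m)) ⟨
    + suc (suc m) * - b ∎
    where
    open ≡-Reasoning
    b = sbinom m 0
    step : ∀ x y → + 1 * (- x - y) ≡ - x - + 1 * y
    step = solve-∀
    collect : ∀ x M → - x - M * x ≡ (+ 1 + M) * - x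
    collect = solve-∀
  sbinom-absorb (suc m) (suc j) = begin
    + suc (suc j) * (b₁ - b₂)
      ≡⟨ cong (_* (b₁ - b₂)) (ℤₚ.pos-+ 1 (suc j)) ⟩
    (+ 1 + j′) * (b₁ - b₂)
      ≡⟨ expand j′ b₁ b₂ ⟩
    b₁ + j′ * b₁ - (+ 1 + j′) * b₂
      ≡⟨ cong₂ (λ u v → b₁ + u - v) (sbinom-absorb m j)
               (trans (cong (_* b₂) (sym (ℤₚ.pos-+ 1 (suc j)))) (sbinom-absorb m (suc j))) ⟩
    b₁ + M * sbinom m j - M * sbinom m (suc j)
      ≡⟨ collect M (sbinom m j) (sbinom m (suc j)) ⟩
    (+ 1 + M) * b₁
      ≡⟨ cong (_* b₁) (ℤₚ.pos-+ 1 (suc m)) ⟨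
    + suc (suc m) * b₁ ∎
    where
    open ≡-Reasoning
    j′ = + suc j
    M = + suc m
    b₁ = sbinom (suc m) (suc j)
    b₂ = sbinom (suc m) (suc (suc j))
    expand : ∀ j x y → (+ 1 + j) * (x - y) ≡ x + j * x - (+ 1 + j) * y
    expand = solve-∀
    collect : ∀ M x y → (x - y) + M * x - M * y ≡ (+ 1 + M) * (x - y)
    collect = solve-∀

  prime∣sbinom : ∀ {m j} → Prime (suc m) → suc j < suc m → suc m ∣ ∣ sbinom (suc m) (suc j) ∣
  prime∣sbinom {m} {j} p-prime 1+j<1+m with euclidsLemma (suc j) ∣ sbinom (suc m) (suc j) ∣ p-prime p∣j*b
    where
    p∣j*b : suc m ∣ suc j ℕ.* ∣ sbinom (suc m) (suc j) ∣
    p∣j*b = subst (suc m ∣_)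
      (trans (sym (ℤₚ.abs-* (+ suc m) (sbinom m j)))
             (trans (cong ∣_∣ (sym (sbinom-absorb m j))) (ℤₚ.abs-* (+ suc j) (sbinom (suc m) (suc j)))))
      (m∣m*n _)
  ... | inj₁ p∣1+j = ⊥-elim (ℕₚ.<⇒≱ 1+j<1+m (∣⇒≤ p∣1+j))
  ... | inj₂ p∣b = p∣b

  sbinom-even : ∀ n → sbinom (n ℕ.* 2) 0 ≡ + 1
  sbinom-even zero = refl
  sbinom-even (suc n) = trans (ℤₚ.neg-involutive (sbinom (n ℕ.* 2) 0)) (sbinom-even n)

  module _ {p} (p-prime : Prime p) where
    open Congruence p

    -- (x - 1)^p has constant term (-1)^p, which is -1 modulo p also for p = 2.
    sbinom[p]0≈-1 : sbinom p 0 ≈ - + 1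
    sbinom[p]0≈-1 with p % 2 | m≡m%n+[m/n]*n p 2 | m%n<n p 2
    ... | 0 | p≡[p/2]*2 | _ with prime⇒irreducible p-prime (divides (p / 2) p≡[p/2]*2)
    ...   | inj₂ refl = ≈-byQuotient (+ 1) refl
    sbinom[p]0≈-1 | 1 | p≡1+[p/2]*2 | _ =
      ≡⇒≈ (trans (cong (λ n → sbinom n 0) p≡1+[p/2]*2) (cong -_ (sbinom-even (p / 2))))
    sbinom[p]0≈-1 | suc (suc _) | _ | s≤s (s≤s ())

  module _ {m} (p-prime : Prime (suc m)) where
    private p = suc m
    open Congruence p

    frobenius : ∀ Q → mul[x-1]^ p Q ≈ₚ shift p Q −ₚ Q
    frobenius Q = mk≈ₚ λ k → begin
      mul[x-1]^ p Q k
        ≡⟨ mul[x-1]^-expansion p Q k ⟩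
      sum≤ m (term k) + sbinom p p * shift p Q k
        ≈⟨ +-cong (sum≤-≈head p m (term k) (interior≈0 k)) (≡⇒≈ (cong (_* shift p Q k) (sbinom-diag p))) ⟩
      sbinom p 0 * Q k + + 1 * shift p Q k
        ≈⟨ +-cong (*-cong (sbinom[p]0≈-1 p-prime) (≡⇒≈ {Q k} refl)) (≡⇒≈ refl) ⟩
      - + 1 * Q k + + 1 * shift p Q k
        ≡⟨ rearrange (Q k) (shift p Q k) ⟩
      shift p Q k - Q k ∎
      where
      open ≈-Reasoning
      term : ℕ → ℕ → ℤ
      term k j = sbinom p j * shift j Q k
      interior≈0 : ∀ k j → j < m → term k (suc j) ≈ + 0
      interior≈0 k j j<m =
        ℤ∣⇒≈0 (ℤ∣.∣m⇒∣m*n {m = sbinom p (suc j)} (shift (suc j) Q k) (ℤ∣.∣ᵤ⇒∣ (prime∣sbinom p-prime (s≤s j<m))))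
      rearrange : ∀ a b → - + 1 * a + + 1 * b ≡ b - a
      rearrange = solve-∀

open Frobenius

module Wilson where

  open import Data.Integer using (_+_; _-_; _*_)

  prod≤ : ℕ → (ℕ → ℤ) → ℤ
  prod≤ zero f = + 1
  prod≤ (suc N) f = prod≤ N f * f (suc N)

  prod≤-cong : ∀ N {f g} → (∀ a → 0 < a → a ≤ N → f a ≡ g a) → prod≤ N f ≡ prod≤ N g
  prod≤-cong zero f≗g = refl
  prod≤-cong (suc N) f≗g =
    cong₂ _*_ (prod≤-cong N λ a 0<a a≤N → f≗g a 0<a (ℕₚ.m≤n⇒m≤1+n a≤N)) (f≗g (suc N) (s≤s z≤n) ℕₚ.≤-refl)

  prod≤-ones : ∀ N f → (∀ a → 0 < a → a ≤ N → f a ≡ + 1) → prod≤ N f ≡ + 1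
  prod≤-ones zero f _ = refl
  prod≤-ones (suc N) f f≡1 =
    cong₂ _*_ (prod≤-ones N f λ a 0<a a≤N → f≡1 a 0<a (ℕₚ.m≤n⇒m≤1+n a≤N)) (f≡1 (suc N) (s≤s z≤n) ℕₚ.≤-refl)

  prod≤-update : ∀ N {j} f g → 0 < j → j ≤ N → g j ≡ + 1 →
                 (∀ a → 0 < a → a ≤ N → a ≢ j → f a ≡ g a) → prod≤ N f ≡ f j * prod≤ N g
  prod≤-update zero f g (s≤s _) ()
  prod≤-update (suc N) {j} f g 0<j j≤1+N gj≡1 f≗g with j ℕ.≟ suc N
  ... | yes refl = begin
    prod≤ N f * f j             ≡⟨ cong (_* f j) (prod≤-cong N λ a 0<a a≤N →
                                     f≗g a 0<a (ℕₚ.m≤n⇒m≤1+n a≤N) (ℕₚ.<⇒≢ (s≤s a≤N))) ⟩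
    prod≤ N g * f j             ≡⟨ rearrange (prod≤ N g) (f j) ⟩
    f j * (prod≤ N g * + 1)     ≡⟨ cong (λ t → f j * (prod≤ N g * t)) gj≡1 ⟨
    f j * (prod≤ N g * g j) ∎
    where
    open ≡-Reasoning
    rearrange : ∀ x y → x * y ≡ y * (x * + 1)
    rearrange = solve-∀
  ... | no j≢1+N = begin
    prod≤ N f * f (suc N)              ≡⟨ cong₂ _*_ (prod≤-update N f g 0<j j≤N gj≡1 λ a 0<a a≤N →
                                                                 f≗g a 0<a (ℕₚ.m≤n⇒m≤1+n a≤N))
                                                    (f≗g (suc N) (s≤s z≤n) ℕₚ.≤-refl (≢-sym j≢1+N)) ⟩
    f j * prod≤ N g * g (suc N)        ≡⟨ ℤₚ.*-assoc (f j) _ _ ⟩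
    f j * (prod≤ N g * g (suc N)) ∎
    where
    open ≡-Reasoning
    j≤N = ℕₚ.≤-pred (ℕₚ.≤∧≢⇒< j≤1+N j≢1+N)

  module _ {n : ℕ} (p-prime : Prime (suc (suc n))) where
    private
      p : ℕ
      p = suc (suc n)
    open Congruence p

    pos[1+y*a] : ∀ y a → + (1 ℕ.+ y ℕ.* a) ≡ + 1 + + y * + a
    pos[1+y*a] y a = trans (ℤₚ.pos-+ 1 (y ℕ.* a)) (cong (λ t → + 1 + t) (ℤₚ.pos-* y a))

    bézout⇒inverse : ∀ {a} → Bézout.Identity 1 p a → Σ[ y ∈ ℤ ] + a * y ≈ + 1
    bézout⇒inverse {a} (Bézout.+- x y 1+y*a≡x*p) = - + y , ≈-byQuotient (- + x) (begin
      + a * - + y - + 1        ≡⟨ rearrange (+ a) (+ y) ⟩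
      - (+ 1 + + y * + a)      ≡⟨ cong -_ (trans (sym (pos[1+y*a] y a)) (cong +_ 1+y*a≡x*p)) ⟩
      - + (x ℕ.* p)            ≡⟨ cong -_ (ℤₚ.pos-* x p) ⟩
      - (+ x * + p)            ≡⟨ ℤₚ.neg-distribˡ-* (+ x) (+ p) ⟩
      - + x * + p ∎)
      where
      open ≡-Reasoning
      rearrange : ∀ a y → a * - y - + 1 ≡ - (+ 1 + y * a)
      rearrange = solve-∀
    bézout⇒inverse {a} (Bézout.-+ x y 1+x*p≡y*a) = + y , ≈-byQuotient (+ x) (begin
      + a * + y - + 1          ≡⟨ cong (_- + 1) (ℤₚ.*-comm (+ a) (+ y)) ⟩
      + y * + a - + 1          ≡⟨ cong (_- + 1) (trans (sym (ℤₚ.pos-* y a)) (cong +_ (sym 1+x*p≡y*a))) ⟩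
      + (1 ℕ.+ x ℕ.* p) - + 1  ≡⟨ cong (_- + 1) (pos[1+y*a] x p) ⟩
      + 1 + + x * + p - + 1    ≡⟨ cancel (+ x * + p) ⟩
      + x * + p ∎)
      where
      open ≡-Reasoning
      cancel : ∀ z → + 1 + z - + 1 ≡ z
      cancel = solve-∀

    inverse-exists : ∀ a → 0 < a → a < p → Σ[ b ∈ ℕ ] b < p × + a * + b ≈ + 1
    inverse-exists a@(suc _) _ a<p with bézout⇒inverse (coprime-Bézout (prime⇒coprime p-prime a<p))
    ... | y , a*y≈1 = y ℤ÷.%ℕ p , ℤ÷.n%ℕd<d y p , ≈-trans (*-congˡ (+ a) (≈-sym (≈-residue y))) a*y≈1

    inv : ℕ → ℕ
    inv zero = 0
    inv a@(suc _) with a ℕ.<? p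
    ... | yes a<p = proj₁ (inverse-exists a (s≤s z≤n) a<p)
    ... | no _ = 0

    inv-spec : ∀ {a} → 0 < a → a < p → inv a < p × + a * + inv a ≈ + 1
    inv-spec {a@(suc _)} _ a<p with a ℕ.<? p
    ... | yes a<p′ = proj₂ (inverse-exists a (s≤s z≤n) a<p′)
    ... | no a≮p = ⊥-elim (a≮p a<p)

    inv-unique : ∀ a {b c} → b < p → c < p → + a * + b ≈ + 1 → + a * + c ≈ + 1 → b ≡ c
    inv-unique a {b} {c} b<p c<p ab≈1 ac≈1 = ≈-residue-unique b<p c<p (begin
      + b                  ≡⟨ ℤₚ.*-identityʳ (+ b) ⟨
      + b * + 1            ≈⟨ *-congˡ (+ b) ac≈1 ⟨
      + b * (+ a * + c)    ≡⟨ reassociate (+ a) (+ b) (+ c) ⟩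
      (+ a * + b) * + c    ≈⟨ *-congʳ ab≈1 (+ c) ⟩
      + 1 * + c            ≡⟨ ℤₚ.*-identityˡ (+ c) ⟩
      + c ∎)
      where
      open ≈-Reasoning
      reassociate : ∀ a b c → b * (a * c) ≡ (a * b) * c
      reassociate = solve-∀

    inv-positive : ∀ {a} → 0 < a → a < p → 0 < inv a
    inv-positive {a} 0<a a<p with inv a | inv-spec 0<a a<p
    ... | zero | _ , a*0≈1 = ⊥-elim (0≢1 (≈-residue-unique (s≤s z≤n) (s≤s (s≤s z≤n))
                                           (≈-trans (≡⇒≈ (sym (ℤₚ.*-zeroʳ (+ a)))) a*0≈1)))
      where 0≢1 : 0 ≢ 1
            0≢1 ()
    ... | suc _ | _ = s≤s z≤n

    inv-involutive : ∀ {a} → 0 < a → a < p → inv (inv a) ≡ a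
    inv-involutive {a} 0<a a<p =
      inv-unique (inv a) (proj₁ (inv-spec 0<inv 1/a<p)) a<p (proj₂ (inv-spec 0<inv 1/a<p))
                 (≈-trans (≡⇒≈ (ℤₚ.*-comm (+ inv a) (+ a))) (proj₂ (inv-spec 0<a a<p)))
      where
      0<inv = inv-positive 0<a a<p
      1/a<p = proj₁ (inv-spec 0<a a<p)

    -- For a + 1 in place of a: (a + 1)² - 1 = a (a + 2), so p divides a or a + 2.
    self-inverse : ∀ {a} → 0 < a → a < p → + a * + a ≈ + 1 → a ≡ 1 ⊎ a ≡ suc n
    self-inverse {suc a} _ a<p a²≈1 with euclidsLemma a (a ℕ.+ 2) p-prime p∣[a-1][a+1]
      where
      a²-1 : + suc a * + suc a - + 1 ≡ + (a ℕ.* (a ℕ.+ 2))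
      a²-1 = trans (cong (λ x → x * x - + 1) (ℤₚ.pos-+ 1 a))
               (trans (factor (+ a)) (trans (cong (+ a *_) (sym (ℤₚ.pos-+ a 2))) (sym (ℤₚ.pos-* a (a ℕ.+ 2)))))
        where factor : ∀ x → (+ 1 + x) * (+ 1 + x) - + 1 ≡ x * (x + + 2)
              factor = solve-∀
      p∣[a-1][a+1] : p ∣ a ℕ.* (a ℕ.+ 2)
      p∣[a-1][a+1] = subst (λ z → p ∣ ∣ z ∣) a²-1 (ℤ∣.∣⇒∣ᵤ (divides-difference a²≈1))
    ... | inj₁ p∣a = inj₁ (cong suc (∣∧<⇒≡0 p∣a (ℕₚ.<-trans (ℕₚ.n<1+n a) a<p)))
    ... | inj₂ p∣a+2 = inj₂ (ℕₚ.suc-injective (ℕₚ.≤-antisym a<p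
            (subst (p ≤_) (ℕₚ.+-comm a 2) (∣⇒≤ ⦃ subst NonZero (ℕₚ.+-comm 2 a) _ ⦄ p∣a+2))))

    inv[p-1] : inv (suc n) ≡ suc n
    inv[p-1] = inv-unique (suc n) (proj₁ (inv-spec 0<p-1 ℕₚ.≤-refl)) ℕₚ.≤-refl
                 (proj₂ (inv-spec 0<p-1 ℕₚ.≤-refl)) (≈-byQuotient (+ n) [p-1]²-1)
      where
      0<p-1 : 0 < suc n
      0<p-1 = s≤s z≤n
      [p-1]²-1 : + suc n * + suc n - + 1 ≡ + n * + p
      [p-1]²-1 = trans (cong (λ x → x * x - + 1) (ℤₚ.pos-+ 1 n))
                   (trans (factor (+ n)) (cong (+ n *_) (sym (ℤₚ.pos-+ 2 n))))
        where factor : ∀ x → (+ 1 + x) * (+ 1 + x) - + 1 ≡ x * (+ 2 + x)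
              factor = solve-∀

    inv-≤n : ∀ {a} → 0 < a → a ≤ n → inv a ≤ n
    inv-≤n {a} 0<a a≤n = ℕₚ.≤-pred (ℕₚ.≤∧≢⇒< (ℕₚ.≤-pred (proj₁ (inv-spec 0<a a<p))) inv≢p-1)
      where
      a<p : a < p
      a<p = ℕₚ.m<n⇒m<1+n (s≤s a≤n)
      inv≢p-1 : inv a ≢ suc n
      inv≢p-1 inv≡p-1 =
        ℕₚ.<-irrefl (trans (sym (inv-involutive 0<a a<p)) (trans (cong inv inv≡p-1) inv[p-1])) (s≤s a≤n)

    -- Among 1 … N, every a whose inverse also lies in 1 … N is paired off and counts as 1.
    weight : ℕ → ℕ → ℤ
    weight N a with inv a ℕ.≤? N
    ... | yes _ = + 1
    ... | no _ = + a

    weight-paired : ∀ {N a} → inv a ≤ N → weight N a ≡ + 1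
    weight-paired {N} {a} inv≤N with inv a ℕ.≤? N
    ... | yes _ = refl
    ... | no inv≰N = ⊥-elim (inv≰N inv≤N)

    weight-unpaired : ∀ {N a} → ¬ inv a ≤ N → weight N a ≡ + a
    weight-unpaired {N} {a} inv≰N with inv a ℕ.≤? N
    ... | yes inv≤N = ⊥-elim (inv≰N inv≤N)
    ... | no _ = refl

    weight-suc : ∀ {N a} → N < n → 0 < a → a ≤ N → a ≢ inv (suc N) → weight (suc N) a ≡ weight N a
    weight-suc {N} {a} N<n 0<a a≤N a≢j with inv a ℕ.≤? suc N | inv a ℕ.≤? N
    ... | yes _ | yes _ = refl
    ... | no _ | no _ = refl
    ... | no inv≰1+N | yes inv≤N = ⊥-elim (inv≰1+N (ℕₚ.m≤n⇒m≤1+n inv≤N))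
    ... | yes inv≤1+N | no inv≰N = ⊥-elim (a≢j (trans (sym (inv-involutive 0<a a<p)) (cong inv inv≡1+N)))
      where
      a<p : a < p
      a<p = ℕₚ.<-trans (s≤s (ℕₚ.≤-trans a≤N (ℕₚ.<⇒≤ N<n))) (ℕₚ.n<1+n (suc n))
      inv≡1+N = ℕₚ.≤-antisym inv≤1+N (ℕₚ.≰⇒> inv≰N)

    module _ {N} (m≤n : suc N ≤ n) (IH : + (N !) ≈ prod≤ N (weight N)) where
      private
        m = suc N
        j = inv m
        0<m : 0 < m
        0<m = s≤s z≤n
        m<p : m < p
        m<p = ℕₚ.<-trans (s≤s m≤n) (ℕₚ.n<1+n (suc n))

      paired-step : j < m → + (m !) ≈ prod≤ m (weight m)
      paired-step j<m = begin
        + (m ℕ.* N !)                         ≡⟨ ℤₚ.pos-* m (N !) ⟩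
        + m * + (N !)                         ≈⟨ *-congˡ (+ m) IH ⟩
        + m * prod≤ N (weight N)              ≡⟨ cong (+ m *_) paired-off ⟩
        + m * (+ j * prod≤ N (weight m))      ≡⟨ reassociate (+ m) (+ j) (prod≤ N (weight m)) ⟩
        (+ m * + j) * prod≤ N (weight m)      ≈⟨ *-congʳ (proj₂ (inv-spec 0<m m<p)) (prod≤ N (weight m)) ⟩
        + 1 * prod≤ N (weight m)              ≡⟨ ℤₚ.*-identityˡ _ ⟩
        prod≤ N (weight m)                    ≡⟨ ℤₚ.*-identityʳ _ ⟨
        prod≤ N (weight m) * + 1              ≡⟨ cong (prod≤ N (weight m) *_) (weight-paired (ℕₚ.<⇒≤ j<m)) ⟨
        prod≤ N (weight m) * weight m m ∎
        where
        open ≈-Reasoning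
        paired-off : prod≤ N (weight N) ≡ + j * prod≤ N (weight m)
        paired-off = trans
          (prod≤-update N (weight N) (weight m) (inv-positive 0<m m<p) (ℕₚ.≤-pred j<m)
            (weight-paired (ℕₚ.≤-reflexive (inv-involutive 0<m m<p)))
            (λ a 0<a a≤N a≢j → sym (weight-suc m≤n 0<a a≤N a≢j)))
          (cong (_* prod≤ N (weight m)) (weight-unpaired {N} {j} λ inv[j]≤N →
            ℕₚ.<-irrefl refl (subst (_≤ N) (inv-involutive 0<m m<p) inv[j]≤N)))
        reassociate : ∀ m j x → m * (j * x) ≡ (m * j) * x
        reassociate = solve-∀

      unpaired-step : m ≤ j → weight m m ≡ + m → + (m !) ≈ prod≤ m (weight m)
      unpaired-step m≤j weight[m]≡m = begin
        + (m ℕ.* N !)                         ≡⟨ ℤₚ.pos-* m (N !) ⟩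
        + m * + (N !)                         ≈⟨ *-congˡ (+ m) IH ⟩
        + m * prod≤ N (weight N)              ≡⟨ ℤₚ.*-comm (+ m) _ ⟩
        prod≤ N (weight N) * + m              ≡⟨ cong₂ _*_ unchanged (sym weight[m]≡m) ⟩
        prod≤ N (weight m) * weight m m ∎
        where
        open ≈-Reasoning
        unchanged : prod≤ N (weight N) ≡ prod≤ N (weight m)
        unchanged = prod≤-cong N λ a 0<a a≤N →
          sym (weight-suc m≤n 0<a a≤N λ a≡j → ℕₚ.<-irrefl a≡j (ℕₚ.<-≤-trans (s≤s a≤N) m≤j))

      !≈prod≤-weight-suc : + (m !) ≈ prod≤ m (weight m)
      !≈prod≤-weight-suc with ℕₚ.<-cmp j m
      ... | tri< j<m _ _ = paired-step j<m
      ... | tri> _ _ m<j = unpaired-step (ℕₚ.<⇒≤ m<j) (weight-unpaired (ℕₚ.<⇒≱ m<j))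
      ... | tri≈ _ j≡m _ with self-inverse 0<m m<p (subst (λ b → + m * + b ≈ + 1) j≡m (proj₂ (inv-spec 0<m m<p)))
      ...   | inj₁ m≡1 = unpaired-step (ℕₚ.≤-reflexive (sym j≡m))
                           (trans (weight-paired (ℕₚ.≤-reflexive j≡m)) (cong +_ (sym m≡1)))
      ...   | inj₂ m≡p-1 = ⊥-elim (ℕₚ.<-irrefl m≡p-1 (s≤s m≤n))

    !≈prod≤-weight : ∀ N → N ≤ n → + (N !) ≈ prod≤ N (weight N)
    !≈prod≤-weight zero _ = ≡⇒≈ refl
    !≈prod≤-weight (suc N) m≤n = !≈prod≤-weight-suc m≤n (!≈prod≤-weight N (ℕₚ.<⇒≤ m≤n))

    wilson : + ((suc n) !) ≈ - + 1
    wilson = begin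
      + (suc n ℕ.* n !)               ≡⟨ ℤₚ.pos-* (suc n) (n !) ⟩
      + suc n * + (n !)               ≈⟨ *-congˡ (+ suc n) (!≈prod≤-weight n ℕₚ.≤-refl) ⟩
      + suc n * prod≤ n (weight n)    ≡⟨ cong (+ suc n *_) all-paired ⟩
      + suc n * + 1                   ≈⟨ ≈-byQuotient (+ 1) (p-1≡-1 (+ n)) ⟩
      - + 1 ∎
      where
      open ≈-Reasoning
      all-paired : prod≤ n (weight n) ≡ + 1
      all-paired = prod≤-ones n (weight n) λ a 0<a a≤n → weight-paired (inv-≤n 0<a a≤n)
      p-1≡-1 : ∀ x → (+ 1 + x) * + 1 - - + 1 ≡ + 1 * (+ 2 + x)
      p-1≡-1 = solve-∀

open Wilson

module PrimeModulus where

  open import Data.Integer using (_+_; _-_; _*_)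

  module _ {n} (p-prime : Prime (suc (suc n))) where
    private
      e = suc n
      p = suc e
      [x-1]^ = (X^ 1 −ₚ X^ 0) ^ₚ_
    open Congruence p

    Gₚ : ℕ → Poly
    Gₚ n = X^ (n % p) ⊗ [x-1]^ (p ℕ.* (n / p))

    Gₚ-residue : ∀ r q → r < p → Gₚ (r ℕ.+ q ℕ.* p) ≗ shift r ([x-1]^ (p ℕ.* q))
    Gₚ-residue r q r<p k = trans
      (cong₂ (λ i j → (X^ i ⊗ [x-1]^ (p ℕ.* j)) k) ([r+q*d]%d≡r q p r<p) ([r+q*d]/d≡q q p r<p))
      (X^⊗≗shift r ([x-1]^ (p ℕ.* q)) k)

    X^≈ₚGₚ : ∀ n → n ≤ e → X^ n ≈ₚ Gₚ n
    X^≈ₚGₚ n n≤e = ≗⇒≈ₚ λ k → sym (begin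
      (X^ (n % p) ⊗ [x-1]^ (p ℕ.* (n / p))) k  ≡⟨ cong₂ (λ i j → (X^ i ⊗ [x-1]^ (p ℕ.* j)) k)
                                                          (m<n⇒m%n≡m (s≤s n≤e)) (m<n⇒m/n≡0 (s≤s n≤e)) ⟩
      (X^ n ⊗ [x-1]^ (p ℕ.* 0)) k               ≡⟨ cong (λ i → (X^ n ⊗ [x-1]^ i) k) (ℕₚ.*-zeroʳ p) ⟩
      (X^ n ⊗ X^ 0) k                            ≡⟨ ⊗-identityʳ (X^ n) k ⟩
      X^ n k ∎)
      where open ≡-Reasoning

    Hₚ≈ₚGₚ : ∀ n → H p n ≈ₚ Gₚ n
    Hₚ≈ₚGₚ = H≈ₚ-byResidue e Gₚ X^≈ₚGₚ step wrap
      where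
      step : ∀ r q → r < e → xmul (Gₚ (r ℕ.+ q ℕ.* p)) ≈ₚ Gₚ (suc r ℕ.+ q ℕ.* p)
      step r q r<e = ≗⇒≈ₚ λ k →
        trans (xmul-≗ (Gₚ-residue r q (ℕₚ.m<n⇒m<1+n r<e)) k) (sym (Gₚ-residue (suc r) q (s≤s r<e) k))
      wrap : ∀ q → xmul (Gₚ (e ℕ.+ q ℕ.* p)) +ₚ (+ (e !)) · Gₚ (q ℕ.* p) ≈ₚ Gₚ (suc q ℕ.* p)
      wrap q = begin
        xmul (Gₚ (e ℕ.+ q ℕ.* p)) +ₚ (+ (e !)) · Gₚ (q ℕ.* p)
          ≈⟨ +ₚ-cong (≗⇒≈ₚ (xmul-≗ (Gₚ-residue e q ℕₚ.≤-refl)))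
                     (·-cong (wilson p-prime) (≗⇒≈ₚ (Gₚ-residue 0 q (s≤s z≤n)))) ⟩
        shift p W +ₚ (- + 1) · W
          ≈⟨ ≗⇒≈ₚ (λ k → minus (shift p W k) (W k)) ⟩
        shift p W −ₚ W
          ≈⟨ frobenius p-prime W ⟨
        mul[x-1]^ p W
          ≈⟨ ≗⇒≈ₚ ([x-1]^-+ p (p ℕ.* q)) ⟨
        [x-1]^ (p ℕ.+ p ℕ.* q)
          ≈⟨ ≗⇒≈ₚ (λ k → cong (λ i → [x-1]^ i k) (ℕₚ.*-suc p q)) ⟨
        [x-1]^ (p ℕ.* suc q)
          ≈⟨ ≗⇒≈ₚ (Gₚ-residue 0 (suc q) (s≤s z≤n)) ⟨
        Gₚ (suc q ℕ.* p) ∎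
        where
        open ≈ₚ-Reasoning
        W = [x-1]^ (p ℕ.* q)
        minus : ∀ a b → a + - + 1 * b ≡ a - b
        minus = solve-∀

open PrimeModulus

open import Data.Nat using (_*_)

mainTheorem13 : (d : ℕ) → 2 ≤ d → .{{_ : NonZero d}} → (n : ℕ) →
    (Composite d → 4 < d → H d n ≡ₚ X^ n [mod d ])
    × (d ≡ 4 →
        (H 4 n ≡ₚ X^ n +ₚ (+ (2 * (n / 4))) · X^ (n ∸ 4) [mod 4 ])
        × (H 4 n ≡ₚ X^ (n ∸ 4 * ((n / 4) % 2)) ⊗ ((X^ 4 +ₚ const (+ 2)) ^ₚ ((n / 4) % 2)) [mod 4 ]))
    × (Prime d → H d n ≡ₚ X^ (n % d) ⊗ ((X^ 1 −ₚ X^ 0) ^ₚ (d * (n / d))) [mod d ])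
mainTheorem13 d@(suc (suc e)) (s≤s (s≤s z≤n)) n =
  (λ composite[d] 4<d → Congruence.≈ₚ⇒≡ₚ d (H≈ₚX^-composite (suc e) composite[d] 4<d n)) ,
  (λ { refl → Congruence.≈ₚ⇒≡ₚ 4 (H₄≈ₚG₄ n) , Congruence.≈ₚ⇒≡ₚ 4 (H₄≈ₚparity-form n) }) ,
  (λ p-prime → Congruence.≈ₚ⇒≡ₚ d (Hₚ≈ₚGₚ p-prime n))
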